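{- Let $G$ be a hypo-efficient domination graph having a $\gamma$-critical vertex. Then \[(\delta(G)+1)(\gamma(G)-1)+1\leq|V(G)|\leq(\Delta(G)+1)(\gamma(G)-1)+1.\]
   Context: All graphs are finite, simple and undirected; $\delta(G)$ and $\Delta(G)$ are the minimum and maximum degree. A dominating set of $G$ is a set $D\subseteq V(G)$ such that every vertex not in $D$ has a neighbor in $D$; $\gamma(G)$ is the minimum size of a dominating set. A vertex $v$ is $\gamma$-critical if $\gamma(G-v)<\gamma(G)$. An efficient dominating set (EDS) of $G$ is a set $D\subseteq V(G)$ with $|N[v]\cap D|=1$ for every $v\in V(G)$, where $N[v]$ is the closed neighborhood of $v$. A graph $G$ is a hypo-efficient domination graph if $G$ has no EDS but $G-v$ has at least one EDS for every $v\in V(G)$. -}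

module Defs where

open import Data.Nat using (ℕ; zero; suc; _⊔_; _⊓_; _≤_; _<_)
open import Data.Bool using (Bool; true; false; _∨_; _∧_)
open import Data.Fin using (Fin; zero; suc; punchIn)
import Data.Fin as F
open import Data.Fin.Subset using (Subset; _∈_; _∩_; ∣_∣)
open import Data.Vec using (tabulate)
open import Data.List using (foldr; map)
open import Data.List using () renaming (allFin to allFinL)
open import Data.Product using (Σ; ∃; _×_; _,_)
open import Data.Sum using (_⊎_)
open import Relation.Nullary using (¬_; does)
open import Relation.Binary.PropositionalEquality using (_≡_)

record Graph (n : ℕ) : Set where
  field
    adj    : Fin n → Fin n → Bool
    sym    : ∀ u v → adj u v ≡ adj v u
    irrefl : ∀ v → adj v v ≡ false
open Graph public

N : ∀ {n} → Graph n → Fin n → Subset n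
N G v = tabulate (λ u → adj G v u)

N[_,_] : ∀ {n} → Graph n → Fin n → Subset n
N[ G , v ] = tabulate (λ u → does (u F.≟ v) ∨ adj G v u)

deg : ∀ {n} → Graph n → Fin n → ℕ
deg G v = ∣ N G v ∣

δ : ∀ {m} → Graph (suc m) → ℕ
δ {m} G = foldr _⊓_ (deg G zero) (map (deg G) (allFinL (suc m)))

Δ : ∀ {m} → Graph (suc m) → ℕ
Δ {m} G = foldr _⊔_ 0 (map (deg G) (allFinL (suc m)))

Dominating : ∀ {n} → Graph n → Subset n → Set
Dominating G D = ∀ v → v ∈ D ⊎ (∃ λ u → adj G v u ≡ true × u ∈ D)

IsDominationNumber : ∀ {n} → Graph n → ℕ → Set
IsDominationNumber G k =
  (∃ λ D → Dominating G D × ∣ D ∣ ≡ k) × (∀ D → Dominating G D → k ≤ ∣ D ∣)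

_-_ : ∀ {m} → Graph (suc m) → Fin (suc m) → Graph m
G - v = record
  { adj    = λ a b → adj G (punchIn v a) (punchIn v b)
  ; sym    = λ a b → sym G (punchIn v a) (punchIn v b)
  ; irrefl = λ a → irrefl G (punchIn v a)
  }

GammaCritical : ∀ {m} → Graph (suc m) → Fin (suc m) → Set
GammaCritical G v = ∃ λ k → ∃ λ k' →
  IsDominationNumber G k × IsDominationNumber (G - v) k' × k' < k

EfficientDominating : ∀ {n} → Graph n → Subset n → Set
EfficientDominating G D = ∀ v → ∣ N[ G , v ] ∩ D ∣ ≡ 1

HasEDS : ∀ {n} → Graph n → Set
HasEDS G = ∃ λ D → EfficientDominating G D

HypoEfficient : ∀ {m} → Graph (suc m) → Set
HypoEfficient G = ¬ HasEDS G × (∀ v → HasEDS (G - v))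

-- Let v be γ-critical and D an efficient dominating set of G - v. Double
-- counting over the closed neighbourhoods, which partition V(G - v), shows that
-- D is a minimum dominating set of G - v, so |D| = γ(G - v) < γ(G); since
-- D ∪ {v} dominates G, γ(G) = |D| + 1. Hence no vertex of D is adjacent to v
-- (else D would dominate G), so the vertices of D keep their degree in G, and
-- |V(G)| - 1 = Σ_{d ∈ D} (deg d + 1) lies between (δ + 1)|D| and (Δ + 1)|D|.
module Submission where

open import Defs
open import Data.Nat using (ℕ; zero; suc; _+_; _*_; _∸_; _≤_; _<_; z≤n; s≤s)
open import Data.Nat.Properties
  using (+-*-semiring; +-comm; +-suc; *-comm; *-identityˡ; +-mono-≤; +-monoˡ-≤; ≤-refl; ≤-antisym;
         <-≤-trans; ≤-<-trans; <⇒≱; m≤n⇒m⊓o≤n; m≤n⇒o⊓m≤n; m≤n⇒m≤n⊔o; m≤n⇒m≤o⊔n; module ≤-Reasoning)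
open import Data.Bool using (Bool; true; false; _∧_; _∨_)
open import Data.Bool.Properties using (∨-zeroʳ)
open import Data.Fin using (Fin; zero; suc; punchIn; punchOut; _≟_)
open import Data.Fin.Properties using (punchInᵢ≢i; punchIn-punchOut)
open import Data.Fin.Subset using (Subset; inside; outside; _∈_; _∩_; ∣_∣; ⊤; Nonempty)
open import Data.Fin.Subset.Properties
  using (∣p∣≤∣x∷p∣; ∣⊤∣≡n; ∣⊥∣≡0; nonempty?; Empty-unique; x∈p∩q⁺; x∈p∩q⁻; ∩-identityʳ)
open import Data.Vec using ([]; _∷_; here; there; lookup; insertAt)
open import Data.Vec.Properties
  using (lookup∘tabulate; lookup-zipWith; []=⇒lookup; lookup⇒[]=; insertAt-lookup; insertAt-punchIn)
open import Data.List.Properties using (foldr-preservesᵒ)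
open import Data.List.Membership.Propositional using (lose)
open import Data.List.Membership.Propositional.Properties using (∈-allFin)
open import Data.List.Relation.Unary.Any.Properties using (map⁺)
open import Data.Product using (∃; _×_; _,_; proj₂)
open import Data.Sum using (_⊎_; inj₁; inj₂; [_,_])
open import Function using (_∘_)
open import Relation.Nullary using (yes; no; does; contradiction)
open import Relation.Nullary.Decidable using (dec-true; dec-false)
open import Relation.Binary.PropositionalEquality
  using (_≡_; _≢_; refl; trans; cong; cong₂; subst; module ≡-Reasoning)
  renaming (sym to ≡-sym)
open import Algebra.Properties.Semiring.Sum +-*-semiring
  using (sum; sum-syntax; sum-cong-≗; sum-remove; ∑-comm; *-distribˡ-sum)

𝟙 : Bool → ℕ
𝟙 true  = 1
𝟙 false = 0

∑-mono-≤ : ∀ {n} {f g : Fin n → ℕ} → (∀ i → f i ≤ g i) → ∑[ i < n ] f i ≤ ∑[ i < n ] g i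
∑-mono-≤ {zero}  f≤g = z≤n
∑-mono-≤ {suc n} f≤g = +-mono-≤ (f≤g zero) (∑-mono-≤ (f≤g ∘ suc))

∣p∣≡∑ : ∀ {n} (p : Subset n) → ∣ p ∣ ≡ ∑[ i < n ] 𝟙 (lookup p i)
∣p∣≡∑ []            = refl
∣p∣≡∑ (inside  ∷ p) = cong suc (∣p∣≡∑ p)
∣p∣≡∑ (outside ∷ p) = ∣p∣≡∑ p

∣p∩q∣≡∑ : ∀ {n} (p q : Subset n) → ∣ p ∩ q ∣ ≡ ∑[ i < n ] 𝟙 (lookup p i ∧ lookup q i)
∣p∩q∣≡∑ p q = trans (∣p∣≡∑ (p ∩ q)) (sum-cong-≗ λ i → cong 𝟙 (lookup-zipWith _∧_ i p q))

∑𝟙*≡*∣p∣ : ∀ {n} (p : Subset n) k → ∑[ i < n ] (𝟙 (lookup p i) * k) ≡ k * ∣ p ∣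
∑𝟙*≡*∣p∣ {n} p k = begin
  ∑[ i < n ] (𝟙 (lookup p i) * k)   ≡⟨ sum-cong-≗ (λ i → *-comm (𝟙 (lookup p i)) k) ⟩
  ∑[ i < n ] (k * 𝟙 (lookup p i))   ≡⟨ *-distribˡ-sum k (𝟙 ∘ lookup p) ⟨
  k * (∑[ i < n ] 𝟙 (lookup p i))  ≡⟨ cong (k *_) (∣p∣≡∑ p) ⟨
  k * ∣ p ∣                       ∎
  where open ≡-Reasoning

∑-mono-≤-on : ∀ {n} (p : Subset n) {f g : Fin n → ℕ} → (∀ {i} → i ∈ p → f i ≤ g i) →
  ∑[ i < n ] (𝟙 (lookup p i) * f i) ≤ ∑[ i < n ] (𝟙 (lookup p i) * g i)
∑-mono-≤-on p {f} {g} f≤g = ∑-mono-≤ pointwise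
  where
  pointwise : ∀ i → 𝟙 (lookup p i) * f i ≤ 𝟙 (lookup p i) * g i
  pointwise i with lookup p i in p[i]
  ... | true  = +-monoˡ-≤ 0 (f≤g (lookup⇒[]= i p p[i]))
  ... | false = z≤n

x∈p⇒0<∣p∣ : ∀ {n} {x : Fin n} {p : Subset n} → x ∈ p → 0 < ∣ p ∣
x∈p⇒0<∣p∣             here        = s≤s z≤n
x∈p⇒0<∣p∣ {p = s ∷ p} (there x∈p) = <-≤-trans (x∈p⇒0<∣p∣ x∈p) (∣p∣≤∣x∷p∣ s p)

∣p∣≢0⇒nonempty : ∀ {n} {p : Subset n} → ∣ p ∣ ≢ 0 → Nonempty p
∣p∣≢0⇒nonempty {n} {p} ∣p∣≢0 with nonempty? p
... | yes p≢∅ = p≢∅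
... | no  p≡∅ = contradiction (trans (cong ∣_∣ (Empty-unique p≡∅)) (∣⊥∣≡0 n)) ∣p∣≢0

∣insertAt∣ : ∀ {n} (p : Subset n) i x → ∣ insertAt p i x ∣ ≡ 𝟙 x + ∣ p ∣
∣insertAt∣ p             zero    inside  = refl
∣insertAt∣ p             zero    outside = refl
∣insertAt∣ (inside  ∷ p) (suc i) x       = trans (cong suc (∣insertAt∣ p i x)) (≡-sym (+-suc (𝟙 x) ∣ p ∣))
∣insertAt∣ (outside ∷ p) (suc i) x       = ∣insertAt∣ p i x

i∈insertAt : ∀ {n} (p : Subset n) i → i ∈ insertAt p i inside
i∈insertAt p i = lookup⇒[]= i _ (insertAt-lookup p i inside)

punchIn∈insertAt : ∀ {n} {p : Subset n} {x} i s → x ∈ p → punchIn i x ∈ insertAt p i s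
punchIn∈insertAt {p = p} {x} i s x∈p =
  lookup⇒[]= (punchIn i x) _ (trans (insertAt-punchIn p i s x) ([]=⇒lookup x∈p))

DominatedBy : ∀ {n} → Graph n → Subset n → Fin n → Set
DominatedBy G S a = a ∈ S ⊎ ∃ λ u → adj G a u ≡ true × u ∈ S

module _ {n} (G : Graph n) where

  lookup-N[] : ∀ a x → lookup N[ G , a ] x ≡ does (x ≟ a) ∨ adj G a x
  lookup-N[] a = lookup∘tabulate _

  N[]-sym : ∀ a b → lookup N[ G , a ] b ≡ lookup N[ G , b ] a
  N[]-sym a b = trans (lookup-N[] a b) (trans (cong₂ _∨_ (≟-sym b a) (sym G a b)) (≡-sym (lookup-N[] b a)))
    where
    ≟-sym : ∀ x y → does (x ≟ y) ≡ does (y ≟ x)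
    ≟-sym x y with x ≟ y
    ... | yes refl = ≡-sym (dec-true (x ≟ x) refl)
    ... | no x≢y   = ≡-sym (dec-false (y ≟ x) (x≢y ∘ ≡-sym))

  ∈N[]⁺ : ∀ {a x} → x ≡ a ⊎ adj G a x ≡ true → x ∈ N[ G , a ]
  ∈N[]⁺ {a} {x} h = lookup⇒[]= x _ (trans (lookup-N[] a x) (closed h))
    where
    closed : x ≡ a ⊎ adj G a x ≡ true → does (x ≟ a) ∨ adj G a x ≡ true
    closed (inj₁ refl) = cong (_∨ adj G a x) (dec-true (x ≟ x) refl)
    closed (inj₂ a~x)  = trans (cong (does (x ≟ a) ∨_) a~x) (∨-zeroʳ _)

  ∈N[]⁻ : ∀ {a x} → x ∈ N[ G , a ] → x ≡ a ⊎ adj G a x ≡ true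
  ∈N[]⁻ {a} {x} x∈N[a] with x ≟ a | trans (≡-sym (lookup-N[] a x)) ([]=⇒lookup x∈N[a])
  ... | yes x≡a | _   = inj₁ x≡a
  ... | no _    | a~x = inj₂ a~x

  dominatedBy⇒nonempty : ∀ {S a} → DominatedBy G S a → Nonempty (N[ G , a ] ∩ S)
  dominatedBy⇒nonempty {a = a} (inj₁ a∈S)           = a , x∈p∩q⁺ (∈N[]⁺ (inj₁ refl) , a∈S)
  dominatedBy⇒nonempty         (inj₂ (u , a~u , u∈S)) = u , x∈p∩q⁺ (∈N[]⁺ (inj₂ a~u) , u∈S)

  nonempty⇒dominatedBy : ∀ {S a} → Nonempty (N[ G , a ] ∩ S) → DominatedBy G S a
  nonempty⇒dominatedBy {S} {a} (u , u∈N[a]∩S) with x∈p∩q⁻ N[ G , a ] S u∈N[a]∩S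
  ... | u∈N[a] , u∈S with ∈N[]⁻ u∈N[a]
  ... | inj₁ refl = inj₁ u∈S
  ... | inj₂ a~u  = inj₂ (u , a~u , u∈S)

  deg≡∑ : ∀ a → deg G a ≡ ∑[ x < n ] 𝟙 (adj G a x)
  deg≡∑ a = trans (∣p∣≡∑ (N G a)) (sum-cong-≗ λ x → cong 𝟙 (lookup∘tabulate (adj G a) x))

  -- Both sides count the pairs (a , b) ∈ A × B with b ∈ N[a], i.e. a ∈ N[b].
  ∑-∣N[]∩∣-sym : ∀ (A B : Subset n) →
    ∑[ a < n ] (𝟙 (lookup A a) * ∣ N[ G , a ] ∩ B ∣) ≡ ∑[ b < n ] (𝟙 (lookup B b) * ∣ N[ G , b ] ∩ A ∣)
  ∑-∣N[]∩∣-sym A B = begin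
    ∑[ a < n ] (𝟙 (lookup A a) * ∣ N[ G , a ] ∩ B ∣)   ≡⟨ sum-cong-≗ (expand A B) ⟩
    ∑[ a < n ] ∑[ b < n ] term A B a b                 ≡⟨ ∑-comm (term A B) ⟩
    ∑[ b < n ] ∑[ a < n ] term A B a b                 ≡⟨ sum-cong-≗ (λ b → sum-cong-≗ (λ a → term-sym a b)) ⟩
    ∑[ b < n ] ∑[ a < n ] term B A b a                 ≡⟨ sum-cong-≗ (expand B A) ⟨
    ∑[ b < n ] (𝟙 (lookup B b) * ∣ N[ G , b ] ∩ A ∣)   ∎
    where
    open ≡-Reasoning
    term : Subset n → Subset n → Fin n → Fin n → ℕ
    term X Y x y = 𝟙 (lookup X x) * 𝟙 (lookup N[ G , x ] y ∧ lookup Y y)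
    expand : ∀ X Y x → 𝟙 (lookup X x) * ∣ N[ G , x ] ∩ Y ∣ ≡ ∑[ y < n ] term X Y x y
    expand X Y x = trans (cong (𝟙 (lookup X x) *_) (∣p∩q∣≡∑ N[ G , x ] Y))
                         (*-distribˡ-sum (𝟙 (lookup X x)) (λ y → 𝟙 (lookup N[ G , x ] y ∧ lookup Y y)))
    𝟙-swap : ∀ x y z → 𝟙 x * 𝟙 (z ∧ y) ≡ 𝟙 y * 𝟙 (z ∧ x)
    𝟙-swap true  true  z     = refl
    𝟙-swap true  false true  = refl
    𝟙-swap true  false false = refl
    𝟙-swap false true  true  = refl
    𝟙-swap false true  false = refl
    𝟙-swap false false z     = refl
    term-sym : ∀ a b → term A B a b ≡ term B A b a
    term-sym a b = trans (𝟙-swap (lookup A a) (lookup B b) (lookup N[ G , a ] b))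
                         (cong (λ t → 𝟙 (lookup B b) * 𝟙 (t ∧ lookup A a)) (N[]-sym a b))

deg-remove : ∀ {m} (G : Graph (suc m)) a v →
  deg G a ≡ 𝟙 (adj G a v) + ∑[ x < m ] 𝟙 (adj G a (punchIn v x))
deg-remove G a v = trans (deg≡∑ G a) (sum-remove {i = v} (𝟙 ∘ adj G a))

∣N[]∣≡1+deg : ∀ {n} (G : Graph n) a → ∣ N[ G , a ] ∣ ≡ suc (deg G a)
∣N[]∣≡1+deg {suc m} G a = begin
  ∣ N[ G , a ] ∣                                           ≡⟨ ∣p∣≡∑ N[ G , a ] ⟩
  ∑[ x < suc m ] 𝟙 (lookup N[ G , a ] x)                   ≡⟨ sum-remove {i = a} (𝟙 ∘ lookup N[ G , a ]) ⟩
  𝟙 (lookup N[ G , a ] a) + ∑[ x < m ] 𝟙 (lookup N[ G , a ] (punchIn a x))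
    ≡⟨ cong₂ _+_ (cong 𝟙 ([]=⇒lookup (∈N[]⁺ G {a} (inj₁ refl)))) (sum-cong-≗ (cong 𝟙 ∘ off-diagonal)) ⟩
  1 + others                                               ≡⟨ cong (λ t → suc (𝟙 t + others)) (irrefl G a) ⟨
  suc (𝟙 (adj G a a) + others)                             ≡⟨ cong suc (deg-remove G a a) ⟨
  suc (deg G a)                                            ∎
  where
  open ≡-Reasoning
  others : ℕ
  others = ∑[ x < m ] 𝟙 (adj G a (punchIn a x))
  off-diagonal : ∀ x → lookup N[ G , a ] (punchIn a x) ≡ adj G a (punchIn a x)
  off-diagonal x = trans (lookup-N[] G a (punchIn a x))
                         (cong (_∨ adj G a (punchIn a x)) (dec-false (punchIn a x ≟ a) (punchInᵢ≢i a x)))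

module _ {n} (G : Graph n) {D : Subset n} (eds : EfficientDominating G D) where

  eds⇒dominating : Dominating G D
  eds⇒dominating a = nonempty⇒dominatedBy G (∣p∣≢0⇒nonempty λ ∣N[a]∩D∣≡0 →
    contradiction (trans (≡-sym (eds a)) ∣N[a]∩D∣≡0) λ ())

  ∑-∣N[]∩D∣ : ∀ X → ∑[ a < n ] (𝟙 (lookup X a) * ∣ N[ G , a ] ∩ D ∣) ≡ ∣ X ∣
  ∑-∣N[]∩D∣ X = trans (sum-cong-≗ λ a → cong (𝟙 (lookup X a) *_) (eds a))
                      (trans (∑𝟙*≡*∣p∣ X 1) (*-identityˡ ∣ X ∣))

  eds-minimum : ∀ {S} → Dominating G S → ∣ D ∣ ≤ ∣ S ∣
  eds-minimum {S} S-dominating = begin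
    ∣ D ∣                                             ≡⟨ *-identityˡ ∣ D ∣ ⟨
    1 * ∣ D ∣                                         ≡⟨ ∑𝟙*≡*∣p∣ D 1 ⟨
    ∑[ b < n ] (𝟙 (lookup D b) * 1)                 ≤⟨ ∑-mono-≤-on D (λ {b} _ → meets-S b) ⟩
    ∑[ b < n ] (𝟙 (lookup D b) * ∣ N[ G , b ] ∩ S ∣) ≡⟨ ∑-∣N[]∩∣-sym G D S ⟩
    ∑[ a < n ] (𝟙 (lookup S a) * ∣ N[ G , a ] ∩ D ∣) ≡⟨ ∑-∣N[]∩D∣ S ⟩
    ∣ S ∣                                             ∎
    where
    open ≤-Reasoning
    meets-S : ∀ b → 1 ≤ ∣ N[ G , b ] ∩ S ∣
    meets-S b = x∈p⇒0<∣p∣ (proj₂ (dominatedBy⇒nonempty G (S-dominating b)))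

  eds-partition : n ≡ ∑[ b < n ] (𝟙 (lookup D b) * suc (deg G b))
  eds-partition = begin
    n                                                 ≡⟨ ∣⊤∣≡n n ⟨
    ∣ ⊤ {n} ∣                                         ≡⟨ ∑-∣N[]∩D∣ ⊤ ⟨
    ∑[ a < n ] (𝟙 (lookup ⊤ a) * ∣ N[ G , a ] ∩ D ∣) ≡⟨ ∑-∣N[]∩∣-sym G ⊤ D ⟩
    ∑[ b < n ] (𝟙 (lookup D b) * ∣ N[ G , b ] ∩ ⊤ ∣) ≡⟨ sum-cong-≗ (λ b → cong (𝟙 (lookup D b) *_) (closed-degree b)) ⟩
    ∑[ b < n ] (𝟙 (lookup D b) * suc (deg G b))     ∎
    where
    open ≡-Reasoning
    closed-degree : ∀ b → ∣ N[ G , b ] ∩ ⊤ ∣ ≡ suc (deg G b)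
    closed-degree b = trans (cong ∣_∣ (∩-identityʳ N[ G , b ])) (∣N[]∣≡1+deg G b)

  eds-order-lower : ∀ {k} → (∀ {b} → b ∈ D → k ≤ deg G b) → suc k * ∣ D ∣ ≤ n
  eds-order-lower {k} k≤deg = begin
    suc k * ∣ D ∣                                 ≡⟨ ∑𝟙*≡*∣p∣ D (suc k) ⟨
    ∑[ b < n ] (𝟙 (lookup D b) * suc k)         ≤⟨ ∑-mono-≤-on D (s≤s ∘ k≤deg) ⟩
    ∑[ b < n ] (𝟙 (lookup D b) * suc (deg G b)) ≡⟨ eds-partition ⟨
    n                                             ∎
    where open ≤-Reasoning

  eds-order-upper : ∀ {k} → (∀ {b} → b ∈ D → deg G b ≤ k) → n ≤ suc k * ∣ D ∣
  eds-order-upper {k} deg≤k = begin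
    n                                             ≡⟨ eds-partition ⟩
    ∑[ b < n ] (𝟙 (lookup D b) * suc (deg G b)) ≤⟨ ∑-mono-≤-on D (s≤s ∘ deg≤k) ⟩
    ∑[ b < n ] (𝟙 (lookup D b) * suc k)         ≡⟨ ∑𝟙*≡*∣p∣ D (suc k) ⟩
    suc k * ∣ D ∣                                 ∎
    where open ≤-Reasoning

δ≤deg : ∀ {m} (G : Graph (suc m)) a → δ G ≤ deg G a
δ≤deg G a = foldr-preservesᵒ {P = _≤ deg G a} (λ x y → [ m≤n⇒m⊓o≤n y , m≤n⇒o⊓m≤n x ]) _ _
  (inj₂ (map⁺ (lose (∈-allFin a) ≤-refl)))

deg≤Δ : ∀ {m} (G : Graph (suc m)) a → deg G a ≤ Δ G
deg≤Δ G a = foldr-preservesᵒ {P = deg G a ≤_} (λ x y → [ m≤n⇒m≤n⊔o y , m≤n⇒m≤o⊔n x ]) _ _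
  (inj₂ (map⁺ (lose (∈-allFin a) ≤-refl)))

domination-number-unique : ∀ {n} (G : Graph n) {k l} →
  IsDominationNumber G k → IsDominationNumber G l → k ≡ l
domination-number-unique G ((D , D-dom , ∣D∣≡k) , k-min) ((E , E-dom , ∣E∣≡l) , l-min) =
  ≤-antisym (subst (_ ≤_) ∣E∣≡l (k-min E E-dom)) (subst (_ ≤_) ∣D∣≡k (l-min D D-dom))

module _ {m} (G : Graph (suc m)) (v : Fin (suc m)) where

  deg-delete : ∀ b → adj G (punchIn v b) v ≡ false → deg (G - v) b ≡ deg G (punchIn v b)
  deg-delete b b≁v = begin
    deg (G - v) b                         ≡⟨ deg≡∑ (G - v) b ⟩
    others                                ≡⟨ cong (λ t → 𝟙 t + others) b≁v ⟨
    𝟙 (adj G (punchIn v b) v) + others    ≡⟨ deg-remove G (punchIn v b) v ⟨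
    deg G (punchIn v b)                   ∎
    where
    open ≡-Reasoning
    others : ℕ
    others = ∑[ x < m ] 𝟙 (adj G (punchIn v b) (punchIn v x))

  dominatedBy-punchIn : ∀ {D a} s → DominatedBy (G - v) D a → DominatedBy G (insertAt D v s) (punchIn v a)
  dominatedBy-punchIn s (inj₁ a∈D)           = inj₁ (punchIn∈insertAt v s a∈D)
  dominatedBy-punchIn s (inj₂ (x , a~x , x∈D)) = inj₂ (punchIn v x , a~x , punchIn∈insertAt v s x∈D)

  insertAt-dominating : ∀ {D s} → Dominating (G - v) D → DominatedBy G (insertAt D v s) v →
    Dominating G (insertAt D v s)
  insertAt-dominating {s = s} D-dom v-dom u with v ≟ u
  ... | yes refl = v-dom
  ... | no  v≢u  = subst (DominatedBy G _) (punchIn-punchOut v≢u) (dominatedBy-punchIn s (D-dom (punchOut v≢u)))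

module _ {m} (G : Graph (suc m)) (v : Fin (suc m)) {γ} (γ-min : ∀ S → Dominating G S → γ ≤ ∣ S ∣)
         {D} (D-dom : Dominating (G - v) D) where

  γ≤1+∣D∣ : γ ≤ suc ∣ D ∣
  γ≤1+∣D∣ = subst (γ ≤_) (∣insertAt∣ D v inside)
    (γ-min _ (insertAt-dominating G v D-dom (inj₁ (i∈insertAt D v))))

  γ≤∣D∣ : ∀ {d} → d ∈ D → adj G (punchIn v d) v ≡ true → γ ≤ ∣ D ∣
  γ≤∣D∣ {d} d∈D d~v = subst (γ ≤_) (∣insertAt∣ D v outside)
    (γ-min _ (insertAt-dominating G v D-dom (inj₂ (punchIn v d , v~d , punchIn∈insertAt v outside d∈D))))
    where
    v~d : adj G v (punchIn v d) ≡ true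
    v~d = trans (sym G v (punchIn v d)) d~v

critical-deletion-eds : ∀ {m} (G : Graph (suc m)) v {γ k D} →
  IsDominationNumber G γ → IsDominationNumber (G - v) k → k < γ → EfficientDominating (G - v) D →
  γ ≡ suc ∣ D ∣ × (∀ {d} → d ∈ D → adj G (punchIn v d) v ≡ false)
critical-deletion-eds G v {γ} {D = D} (_ , γ-min) ((S , S-dom , ∣S∣≡k) , _) k<γ eds =
  ≤-antisym (γ≤1+∣D∣ G v γ-min D-dom) ∣D∣<γ , D≁v
  where
  D-dom : Dominating (G - v) D
  D-dom = eds⇒dominating (G - v) eds
  ∣D∣<γ : ∣ D ∣ < γ
  ∣D∣<γ = ≤-<-trans (subst (∣ D ∣ ≤_) ∣S∣≡k (eds-minimum (G - v) eds S-dom)) k<γ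
  D≁v : ∀ {d} → d ∈ D → adj G (punchIn v d) v ≡ false
  D≁v {d} d∈D with adj G (punchIn v d) v in d~v
  ... | false = refl
  ... | true  = contradiction (γ≤∣D∣ G v γ-min D-dom d∈D d~v) (<⇒≱ ∣D∣<γ)

+1-*-+1≡suc : ∀ a c → (a + 1) * c + 1 ≡ suc (suc a * c)
+1-*-+1≡suc a c = trans (+-comm _ 1) (cong (λ x → suc (x * c)) (+-comm a 1))

theorem3p16 : ∀ {m} (G : Graph (suc m)) → HypoEfficient G →
    (∃ λ v → GammaCritical G v) →
    ∀ γ → IsDominationNumber G γ →
    ((δ G + 1) * (γ ∸ 1) + 1 ≤ suc m) × (suc m ≤ (Δ G + 1) * (γ ∸ 1) + 1)
theorem3p16 {m} G (_ , deletions-have-eds) (v , k , k' , k-number , k'-number , k'<k) γ γ-number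
  with deletions-have-eds v
... | D , eds
  with critical-deletion-eds G v γ-number k'-number
         (subst (k' <_) (domination-number-unique G k-number γ-number) k'<k) eds
... | refl , D≁v =
  subst (_≤ suc m) (≡-sym (+1-*-+1≡suc (δ G) ∣ D ∣))
    (s≤s (eds-order-lower (G - v) eds (λ d∈D → subst (δ G ≤_) (≡-sym (deg-kept d∈D)) (δ≤deg G _)))) ,
  subst (suc m ≤_) (≡-sym (+1-*-+1≡suc (Δ G) ∣ D ∣))
    (s≤s (eds-order-upper (G - v) eds (λ d∈D → subst (_≤ Δ G) (≡-sym (deg-kept d∈D)) (deg≤Δ G _))))
  where
  deg-kept : ∀ {d} → d ∈ D → deg (G - v) d ≡ deg G (punchIn v d)
  deg-kept d∈D = deg-delete G v _ (D≁v d∈D)
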